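{- If $m$ is a mono in $\mathbf{OA}$, then the following hold identically: (1) if $x_1\bowtie x_2$, then $m x_1\bowtie m x_2$; (2) if $\mathrm{Pos}(x)$, then $\mathrm{Pos}(mx)$; (3) $m^\dagger 1=1$; (4) $x\leq m^\dagger m x$. Symmetrically, if $e$ is an epi in $\mathbf{OA}$, then the following hold identically: (1) if $y_1\bowtie y_2$, then $e^\dagger y_1\bowtie e^\dagger y_2$; (2) if $\mathrm{Pos}(y)$, then $\mathrm{Pos}(e^\dagger y)$; (3) $e1=1$; (4) $y\leq ee^\dagger y$.
   Context: Work in intuitionistic logic without choice. A positivity predicate on a complete lattice $L$ is a unary predicate $\mathrm{Pos}$ such that: (i) $\mathrm{Pos}(x)$ and $x\le y$ imply $\mathrm{Pos}(y)$; (ii) $\mathrm{Pos}(\bigvee X)$ implies $\mathrm{Pos}(x)$ for some $x\in X$; (iii) if $\mathrm{Pos}(x)\Rightarrow x\le y$, then $x\le y$. An o-algebra is a frame $L$ with a positivity predicate such that for all $x,y$: if $\mathrm{Pos}(z\wedge x)\Rightarrow\mathrm{Pos}(z\wedge y)$ for every $z\in L$, then $x\le y$. Write $x\bowtie y$ (overlap) for $\mathrm{Pos}(x\wedge y)$. Functions $f:L\to M$, $g:M\to L$ are symmetric if $f(x)\bowtie y\iff x\bowtie g(y)$; $f$ is symmetrizable if it has a (unique) symmetric $f^\dagger$. $\mathbf{OA}$ is the category of o-algebras and symmetrizable functions. -}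

module Defs where

open import Level using (Level; 0ℓ) renaming (suc to lsuc)
open import Data.Product using (Σ; ∃; _×_; _,_; proj₁; proj₂)

-- Complete lattices / frames, presented predicatively:
-- carrier in Set₁, order and positivity small (Set), joins of all
-- families indexed by small types (I : Set).  Equality of elements is
-- the order-induced equivalence _≈_ (x ≤ y and y ≤ x).

record OAlg : Set₂ where
  infix 4 _≤_
  infixr 7 _∧_
  field
    Carrier  : Set₁
    _≤_      : Carrier → Carrier → Set
    ≤-refl   : ∀ {x} → x ≤ x
    ≤-trans  : ∀ {x y z} → x ≤ y → y ≤ z → x ≤ z
    ⋁        : {I : Set} → (I → Carrier) → Carrier
    ⋁-upper  : {I : Set} (f : I → Carrier) (i : I) → f i ≤ ⋁ f
    ⋁-least  : {I : Set} (f : I → Carrier) (u : Carrier) →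
               (∀ i → f i ≤ u) → ⋁ f ≤ u
    top      : Carrier
    top-max  : ∀ {x} → x ≤ top
    _∧_      : Carrier → Carrier → Carrier
    ∧-lb₁    : ∀ {x y} → x ∧ y ≤ x
    ∧-lb₂    : ∀ {x y} → x ∧ y ≤ y
    ∧-glb    : ∀ {x y z} → z ≤ x → z ≤ y → z ≤ x ∧ y
    ∧-⋁-distrib : ∀ {I : Set} (x : Carrier) (f : I → Carrier) →
                  x ∧ ⋁ f ≤ ⋁ (λ i → x ∧ f i)
    Pos       : Carrier → Set
    Pos-mono  : ∀ {x y} → Pos x → x ≤ y → Pos y
    Pos-⋁     : {I : Set} (f : I → Carrier) → Pos (⋁ f) → Σ I (λ i → Pos (f i))
    Pos-pos   : ∀ {x y} → (Pos x → x ≤ y) → x ≤ y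
    oalg      : ∀ {x y} → (∀ z → Pos (z ∧ x) → Pos (z ∧ y)) → x ≤ y

  infix 4 _≈_ _⋈_
  _≈_ : Carrier → Carrier → Set
  x ≈ y = (x ≤ y) × (y ≤ x)

  _⋈_ : Carrier → Carrier → Set
  x ⋈ y = Pos (x ∧ y)

open OAlg

Symmetric : (L M : OAlg) → (Carrier L → Carrier M) → (Carrier M → Carrier L) → Set₁
Symmetric L M f g = ∀ x y → (_⋈_ M (f x) y → _⋈_ L x (g y)) × (_⋈_ L x (g y) → _⋈_ M (f x) y)

-- morphisms of OA: symmetrizable functions, together with their
-- (unique) symmetric partner f†
record Hom (L M : OAlg) : Set₁ where
  field
    fun  : Carrier L → Carrier M
    dag  : Carrier M → Carrier L
    symm : Symmetric L M fun dag
open Hom public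

_≗H_ : {L M : OAlg} → Hom L M → Hom L M → Set₁
_≗H_ {L} {M} g h = ∀ x → _≈_ M (fun g x) (fun h x)

_∘H_ : {K L M : OAlg} → Hom L M → Hom K L → Hom K M
_∘H_ {K} {L} {M} g h = record
  { fun  = λ x → fun g (fun h x)
  ; dag  = λ z → dag h (dag g z)
  ; symm = λ x z → (λ p → proj₁ (symm h x (dag g z)) (proj₁ (symm g (fun h x) z) p))
                 , (λ p → proj₂ (symm g (fun h x) z) (proj₂ (symm h x (dag g z)) p)) }

Mono : {L M : OAlg} → Hom L M → Set₂
Mono {L} {M} m = ∀ (K : OAlg) (g h : Hom K L) → (m ∘H g) ≗H (m ∘H h) → g ≗H h

Epi : {L M : OAlg} → Hom L M → Set₂
Epi {L} {M} e = ∀ (N : OAlg) (g h : Hom M N) → (g ∘H e) ≗H (h ∘H e) → g ≗H h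

module Submission where

-- Everything rests on clause (2) for monos: a mono m preserves
-- positivity, i.e. Pos x implies Pos (m x).  To see this, probe L with the
-- o-algebra Ω of propositions: every element a gives a morphism
-- point a : Ω → L sending a proposition Q to the truncation a ↾ Q = ⋁_{q:Q} a.
-- With P = Pos (m x), the morphisms point x and point (x ↾ P) agree after
-- composing with m, so they agree, whence x ≤ x ↾ P and Pos x yields P.
-- Clause (1) follows since m is monotone, clause (4) from (1) and symmetry,
-- and clause (3) from (4).
--
-- The epi half is the dual: daggers are determined by the underlying
-- functions, so if e is epi then the opposite morphism op e = (e†, e) is
-- mono, and the four epi clauses for e are literally the mono clauses
-- for op e.

open import Defs
open import Data.Product using (_×_; Σ; _,_; proj₁; proj₂)
open import Data.Unit using (⊤; tt)

module Basics (L : OAlg) where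
  open OAlg L

  ∧-comm-≤ : ∀ {a b} → a ∧ b ≤ b ∧ a
  ∧-comm-≤ = ∧-glb ∧-lb₂ ∧-lb₁

  ∧-monoˡ : ∀ {a a' b} → a ≤ a' → a ∧ b ≤ a' ∧ b
  ∧-monoˡ h = ∧-glb (≤-trans ∧-lb₁ h) ∧-lb₂

  ⋈-comm : ∀ {a b} → a ⋈ b → b ⋈ a
  ⋈-comm p = Pos-mono p ∧-comm-≤

  ⋈-monoˡ : ∀ {a a' b} → a ≤ a' → a ⋈ b → a' ⋈ b
  ⋈-monoˡ h p = Pos-mono p (∧-monoˡ h)

  infixl 8 _↾_
  _↾_ : Carrier → Set → Carrier
  a ↾ Q = ⋁ {Q} (λ _ → a)

  ↾-≤ : ∀ a Q → a ↾ Q ≤ a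
  ↾-≤ a Q = ⋁-least _ a (λ _ → ≤-refl)

  ↾-intro : ∀ {a Q} → Q → a ≤ a ↾ Q
  ↾-intro q = ⋁-upper _ q

  ↾-mono : ∀ {a b} Q → a ≤ b → a ↾ Q ≤ b ↾ Q
  ↾-mono Q h = ⋁-least _ _ (λ q → ≤-trans h (↾-intro q))

  ↾-Pos : ∀ {a Q} → Pos (a ↾ Q) → Q
  ↾-Pos p = proj₁ (Pos-⋁ _ p)

Ω : OAlg
Ω = record
  { Carrier = Set
  ; _≤_ = λ P Q → P → Q
  ; ≤-refl = λ p → p
  ; ≤-trans = λ f g p → g (f p)
  ; ⋁ = λ {I} f → Σ I f
  ; ⋁-upper = λ f i p → i , p
  ; ⋁-least = λ f u h (i , p) → h i p
  ; top = ⊤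
  ; top-max = λ _ → tt
  ; _∧_ = _×_
  ; ∧-lb₁ = proj₁
  ; ∧-lb₂ = proj₂
  ; ∧-glb = λ f g p → f p , g p
  ; ∧-⋁-distrib = λ x f (p , (i , q)) → i , (p , q)
  ; Pos = λ P → P
  ; Pos-mono = λ p f → f p
  ; Pos-⋁ = λ f p → p
  ; Pos-pos = λ f p → f p p
  ; oalg = λ h p → proj₂ (h ⊤ (tt , p))
  }

point : (L : OAlg) → OAlg.Carrier L → Hom Ω L
point L a = record
  { fun  = λ Q → a ↾ Q
  ; dag  = λ y → a ⋈ y
  ; symm = λ Q y → truncation-overlap-out Q y , truncation-overlap-in Q y
  }
  where
  open OAlg L
  open Basics L

  truncation-overlap-out : ∀ Q y → (a ↾ Q) ⋈ y → Q × (a ⋈ y)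
  truncation-overlap-out Q y p =
    let (q , r) = Pos-⋁ _ (Pos-mono (⋈-comm p) (∧-⋁-distrib y (λ _ → a)))
    in q , ⋈-comm r

  truncation-overlap-in : ∀ Q y → Q × (a ⋈ y) → (a ↾ Q) ⋈ y
  truncation-overlap-in Q y (q , r) = ⋈-monoˡ (↾-intro q) r

op : {L M : OAlg} → Hom L M → Hom M L
op {L} {M} f = record
  { fun  = dag f
  ; dag  = fun f
  ; symm = λ y x → (λ p → Basics.⋈-comm M (proj₂ (symm f x y) (Basics.⋈-comm L p)))
                 , (λ p → Basics.⋈-comm L (proj₁ (symm f x y) (Basics.⋈-comm M p)))
  }

fun-mono : {L M : OAlg} (f : Hom L M) {x x' : OAlg.Carrier L} →
           OAlg._≤_ L x x' → OAlg._≤_ M (fun f x) (fun f x')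
fun-mono {L} {M} f {x} {x'} h = OAlg.oalg M λ z p →
  ⋈-comm M (proj₂ (symm f x' z) (⋈-monoˡ L h (proj₁ (symm f x z) (⋈-comm M p))))
  where open Basics

dag-mono : {L M : OAlg} (f : Hom L M) {y y' : OAlg.Carrier M} →
           OAlg._≤_ M y y' → OAlg._≤_ L (dag f y) (dag f y')
dag-mono f = fun-mono (op f)

dag-≤ : {L M : OAlg} (f g : Hom L M) →
        (∀ x → OAlg._≤_ M (fun f x) (fun g x)) →
        ∀ y → OAlg._≤_ L (dag f y) (dag g y)
dag-≤ {L} {M} f g h y = OAlg.oalg L λ z p →
  proj₁ (symm g z y) (Basics.⋈-monoˡ M (h z) (proj₂ (symm f z y) p))

≗H-op : {L M : OAlg} {f g : Hom L M} → f ≗H g → op f ≗H op g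
≗H-op {f = f} {g} eq y = dag-≤ f g (λ x → proj₁ (eq x)) y
                       , dag-≤ g f (λ x → proj₂ (eq x)) y

epi⇒op-mono : {L M : OAlg} (e : Hom L M) → Epi e → Mono (op e)
epi⇒op-mono {L} {M} e epi K g h eq =
  ≗H-op {M} {K} {op g} {op h}
    (epi K (op g) (op h) (≗H-op {K} {L} {op e ∘H g} {op e ∘H h} eq))

mono-Pos : {L M : OAlg} (m : Hom L M) → Mono m →
           ∀ x → OAlg.Pos L x → OAlg.Pos M (fun m x)
mono-Pos {L} {M} m mono x px = ↾-Pos (Pos-mono px x≤x↾P)
  where
  open OAlg L
  open Basics L

  P : Set
  P = OAlg.Pos M (fun m x)

  -- m (x ↾ Q) is positive only if P holds, and then x ≤ x ↾ P.
  same-image : (m ∘H point L x) ≗H (m ∘H point L (x ↾ P))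
  same-image Q =
      OAlg.Pos-pos M (λ pos → fun-mono m (↾-mono Q (↾-intro
        (OAlg.Pos-mono M pos (fun-mono m (↾-≤ x Q))))))
    , fun-mono m (↾-mono Q (↾-≤ x P))

  x≤x↾P : x ≤ x ↾ P
  x≤x↾P = ≤-trans (↾-intro tt)
            (≤-trans (proj₁ (mono Ω (point L x) (point L (x ↾ P)) same-image ⊤))
                     (↾-≤ (x ↾ P) ⊤))

MonoProperties : (L M : OAlg) → Hom L M → Set₁
MonoProperties L M m =
    (∀ x₁ x₂ → OAlg._⋈_ L x₁ x₂ → OAlg._⋈_ M (fun m x₁) (fun m x₂))
  × (∀ x → OAlg.Pos L x → OAlg.Pos M (fun m x))
  × OAlg._≈_ L (dag m (OAlg.top M)) (OAlg.top L)
  × (∀ x → OAlg._≤_ L x (dag m (fun m x)))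

mono-properties : {L M : OAlg} (m : Hom L M) → Mono m → MonoProperties L M m
mono-properties {L} {M} m mono = overlap-preserved , mono-Pos m mono , top-fixed , unit
  where
  open OAlg L

  overlap-preserved : ∀ x₁ x₂ → x₁ ⋈ x₂ → OAlg._⋈_ M (fun m x₁) (fun m x₂)
  overlap-preserved x₁ x₂ p = OAlg.Pos-mono M (mono-Pos m mono _ p)
    (OAlg.∧-glb M (fun-mono m ∧-lb₁) (fun-mono m ∧-lb₂))

  unit : ∀ x → x ≤ dag m (fun m x)
  unit x = oalg λ z p → proj₁ (symm m z (fun m x)) (overlap-preserved z x p)

  top-fixed : dag m (OAlg.top M) ≈ top
  top-fixed = top-max , ≤-trans (unit top) (dag-mono m (OAlg.top-max M))

proposition4p6 :
    ((L M : OAlg) (m : Hom L M) → Mono m →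
      ((∀ x₁ x₂ → OAlg._⋈_ L x₁ x₂ → OAlg._⋈_ M (fun m x₁) (fun m x₂))
      × (∀ x → OAlg.Pos L x → OAlg.Pos M (fun m x))
      × OAlg._≈_ L (dag m (OAlg.top M)) (OAlg.top L)
      × (∀ x → OAlg._≤_ L x (dag m (fun m x)))))
    ×
    ((L M : OAlg) (e : Hom L M) → Epi e →
      ((∀ y₁ y₂ → OAlg._⋈_ M y₁ y₂ → OAlg._⋈_ L (dag e y₁) (dag e y₂))
      × (∀ y → OAlg.Pos M y → OAlg.Pos L (dag e y))
      × OAlg._≈_ M (fun e (OAlg.top L)) (OAlg.top M)
      × (∀ y → OAlg._≤_ M y (fun e (dag e y)))))
proposition4p6 =
    (λ L M m mono → mono-properties m mono)
  , (λ L M e epi → mono-properties (op e) (epi⇒op-mono e epi))
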